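{- The vincular patterns $124\text{ - }3$ and $134\text{ - }2$ are Wilf-equivalent. Furthermore, for all $n\ge1$ and $a\in[n]$, the number of permutations in $\mathcal{S}_n$ avoiding $124\text{ - }3$ with first letter $a$ equals the number of permutations in $\mathcal{S}_n$ avoiding $134\text{ - }2$ with first letter $a$.
   Context: A vincular pattern is a permutation $\rho\in\mathcal{S}_m$ written with dashes between some consecutive entries; $\pi\in\mathcal{S}_n$ contains it if there are indices $i_1<\cdots<i_m$ with $\pi_{i_1}\cdots\pi_{i_m}$ order-isomorphic to $\rho$ and $i_{j+1}=i_j+1$ whenever $\rho_j,\rho_{j+1}$ are not separated by a dash; otherwise $\pi$ avoids it. Patterns are Wilf-equivalent if they are avoided by equally many permutations of length $n$ for every $n\ge0$. -}

module Defs where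

open import Data.Bool using (Bool; true; false; _∧_; _∨_; not; if_then_else_)
open import Data.Nat using (ℕ; zero; suc; _+_; _≡ᵇ_; _<ᵇ_)
open import Data.List using (List; []; _∷_; map; concatMap; filter; length; concat; upTo; zip; _++_)
open import Data.Bool.ListAction using (any; all)
open import Data.Product using (_×_; _,_; proj₁; proj₂)
open import Relation.Binary.PropositionalEquality using (_≡_)
open import Data.Maybe using (Maybe; just; nothing)

-- Conventions: a permutation π ∈ S_n is the list π₁ … πₙ of its values,
-- a list of length n over {1,…,n} with no repeated entry.
-- Positions are 1-based.

words : ℕ → ℕ → List (List ℕ)
words zero    n = [] ∷ []
words (suc k) n = concatMap (λ x → map (x ∷_) (words k n)) (map suc (upTo n))

distinct : List ℕ → Bool
distinct []       = true
distinct (x ∷ xs) = not (any (x ≡ᵇ_) xs) ∧ distinct xs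

S : ℕ → List (List ℕ)
S n = filter (λ w → distinct w Data.Bool.≟ true) (words n n)

-- A vincular pattern is given as its list of blocks: entries inside a block
-- are adjacent (no dash), consecutive blocks are separated by a dash.
-- E.g. 124-3 is (1 ∷ 2 ∷ 4 ∷ []) ∷ (3 ∷ []) ∷ [].
Vincular : Set
Vincular = List (List ℕ)

word : Vincular → List ℕ
word = concat

-- adjacency flags: for each consecutive pair (ρ_j, ρ_{j+1}), true iff
-- they are NOT separated by a dash (length = |ρ| - 1 when ρ nonempty)
adjFlags : Vincular → List Bool
adjFlags []             = []
adjFlags (b ∷ [])       = inner b
  where
  inner : List ℕ → List Bool
  inner []           = []
  inner (_ ∷ [])     = []
  inner (_ ∷ y ∷ ys) = true ∷ inner (y ∷ ys)
adjFlags (b ∷ c ∷ bs)   = inner b ++ (false ∷ adjFlags (c ∷ bs))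
  where
  inner : List ℕ → List Bool
  inner []           = []
  inner (_ ∷ [])     = []
  inner (_ ∷ y ∷ ys) = true ∷ inner (y ∷ ys)

-- entry at 1-based position i (0 if out of range)
at : List ℕ → ℕ → ℕ
at []       _             = 0
at (x ∷ xs) zero          = 0
at (x ∷ xs) (suc zero)    = x
at (x ∷ xs) (suc (suc i)) = at xs (suc i)

indicesOK : List Bool → List ℕ → Bool
indicesOK _             []           = true
indicesOK _             (_ ∷ [])     = true
indicesOK []            (i ∷ j ∷ js) = (i <ᵇ j) ∧ indicesOK [] (j ∷ js)
indicesOK (f ∷ fs)      (i ∷ j ∷ js) =
  (if f then (suc i ≡ᵇ j) else (i <ᵇ j)) ∧ indicesOK fs (j ∷ js)

orderIso : List ℕ → List ℕ → Bool
orderIso xs ys =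
  all (λ p → all (λ q → eqB (proj₁ p <ᵇ proj₁ q)
                              (proj₂ p <ᵇ proj₂ q))
                 (zip xs ys))
      (zip xs ys)
  where
  eqB : Bool → Bool → Bool
  eqB true  b = b
  eqB false b = not b

contains : Vincular → List ℕ → Bool
contains p π =
  any (λ is → indicesOK (adjFlags p) is ∧ orderIso (word p) (map (at π) is))
      (words (length (word p)) (length π))

avoids : Vincular → List ℕ → Bool
avoids p π = not (contains p π)

numAvoiders : Vincular → ℕ → ℕ
numAvoiders p n = length (filter (λ π → avoids p π Data.Bool.≟ true) (S n))

firstIs : ℕ → List ℕ → Bool
firstIs a []      = false
firstIs a (x ∷ _) = x ≡ᵇ a

numAvoidersFirst : Vincular → ℕ → ℕ → ℕ
numAvoidersFirst p n a =
  length (filter (λ π → (avoids p π ∧ firstIs a π) Data.Bool.≟ true) (S n))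

WilfEquivalent : Vincular → Vincular → Set
WilfEquivalent p q = ∀ n → numAvoiders p n ≡ numAvoiders q n

p124-3 : Vincular
p124-3 = (1 ∷ 2 ∷ 4 ∷ []) ∷ (3 ∷ []) ∷ []

p134-2 : Vincular
p134-2 = (1 ∷ 3 ∷ 4 ∷ []) ∷ (2 ∷ []) ∷ []

-- A permutation π ∈ Sₙ is determined by its Lehmer code c, where cᵢ counts the later entries
-- smaller than πᵢ; the codes are exactly the sequences with cᵢ ≤ n − i, and c₁ = π₁ − 1.
-- Because the first three letters of both patterns are adjacent, π contains 124-3 iff its code
-- has three consecutive entries cᵢ ≤ cᵢ₊₁ < cᵢ₊₂, and contains 134-2 iff it has three
-- consecutive entries cᵢ < cᵢ₊₁ ≤ cᵢ₊₂. Scanning a code from the left and replacing cᵢ₊₁ by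
-- the previous output eᵢ whenever eᵢ ≤ cᵢ₊₁ ≤ cᵢ₊₂ is a bijection Φ from codes without the
-- first kind of triple onto codes without the second; it keeps the length, the bounds
-- cᵢ ≤ n − i and the first entry, hence also the first letter of the permutation.

module Submission where

open import Defs
open import Data.Bool using (Bool; true; false; T; not; _∧_)
open import Data.Bool.ListAction using (any; all)
open import Data.Bool.Properties using (T-≡; T-∧; ∧-identityʳ) renaming (_≟_ to _≟ᵇ_)
open import Data.Nat using (ℕ; zero; suc; _+_; _≤_; _<_; z≤n; s≤s; _≡ᵇ_; _<ᵇ_; _<?_; _≤?_)
open import Data.Nat.Properties
open import Data.List
  using (List; []; _∷_; _++_; map; zip; filter; length; upTo; concatMap; cartesianProductWith)
open import Data.List.Properties
  using (length-map; length-upTo; length-++-sucʳ; ∷-injective; ∷-injectiveˡ; ∷-injectiveʳ;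
         filter-accept; filter-reject; filter-≐; length-filter)
open import Data.List.Membership.Propositional using (_∈_; _∉_; find; lose)
open import Data.List.Membership.Propositional.Properties
open import Data.List.Relation.Binary.Subset.Propositional using (_⊆_)
open import Data.List.Relation.Unary.All as All using (All; []; _∷_)
open import Data.List.Relation.Unary.All.Properties using (all⁺; all⁻)
open import Data.List.Relation.Unary.Any using (here; there; any?)
open import Data.List.Relation.Unary.Any.Properties using (any⁺; any⁻)
open import Data.List.Relation.Unary.Unique.Propositional using (Unique; []; _∷_)
open import Data.List.Relation.Unary.Unique.Propositional.Properties
  using (filter⁺; map⁺; upTo⁺; cartesianProductWith⁺)
open import Data.Fin using (#_)
open import Data.Product using (_×_; _,_; proj₁; proj₂; ∃-syntax)
open import Data.Sum using (inj₁; inj₂)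
open import Data.Unit using (⊤; tt)
open import Data.Empty using (⊥)
open import Function using (_∘_; _⇔_; mk⇔; Equivalence)
open import Function.Properties.Equivalence using () renaming (sym to ⇔-sym; trans to ⇔-trans)
open import Relation.Binary using (DecidableEquality; tri<; tri≈; tri>)
open import Relation.Binary.PropositionalEquality
open import Relation.Unary using (Decidable)
open import Relation.Nullary using (¬_; Dec; yes; no; contradiction; _×-dec_)

T-not⁻ : ∀ {b} → T (not b) → ¬ T b
T-not⁻ {true} ()

T-not⁺ : ∀ {b} → ¬ T b → T (not b)
T-not⁺ {false} _ = tt
T-not⁺ {true} ¬t = ¬t tt

infixr 4 _&_
_&_ : ∀ {a b} → T a → T b → T (a ∧ b)
ta & tb = Equivalence.from T-∧ (ta , tb)

all²-lookup : ∀ {A : Set} {f : A → A → Bool} xs {u v} →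
  T (all (λ p → all (f p) xs) xs) → u ∈ xs → v ∈ xs → T (f u v)
all²-lookup {f = f} xs t u∈ v∈ = All.lookup (all⁺ (f _) xs (All.lookup (all⁺ _ xs t) u∈)) v∈

module _ {A : Set} where

  ∈-∷-≢ : ∀ {v x : A} {xs} → v ∈ x ∷ xs → v ≢ x → v ∈ xs
  ∈-∷-≢ (here v≡x) v≢x = contradiction v≡x v≢x
  ∈-∷-≢ (there v∈) _   = v∈

  ∈-++-∷⁻ : ∀ {v x : A} ys zs → v ∈ ys ++ x ∷ zs → v ≢ x → v ∈ ys ++ zs
  ∈-++-∷⁻ ys zs v∈ v≢x with ∈-++⁻ ys v∈
  ... | inj₁ v∈ys         = ∈-++⁺ˡ v∈ys
  ... | inj₂ (here v≡x)   = contradiction v≡x v≢x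
  ... | inj₂ (there v∈zs) = ∈-++⁺ʳ ys v∈zs

  unique-⊆⇒length≤ : ∀ {xs ys : List A} → Unique xs → xs ⊆ ys → length xs ≤ length ys
  unique-⊆⇒length≤ [] _ = z≤n
  unique-⊆⇒length≤ {x ∷ xs} (x∉xs ∷ u) x∷xs⊆ys
    with ys₁ , ys₂ , refl ← ∈-∃++ (x∷xs⊆ys (here refl)) = begin
      suc (length xs)           ≤⟨ s≤s (unique-⊆⇒length≤ u xs⊆ys₁ys₂) ⟩
      suc (length (ys₁ ++ ys₂)) ≡⟨ length-++-sucʳ ys₁ x ys₂ ⟨
      length (ys₁ ++ x ∷ ys₂)   ∎
    where
    open ≤-Reasoning
    xs⊆ys₁ys₂ : xs ⊆ ys₁ ++ ys₂
    xs⊆ys₁ys₂ v∈xs = ∈-++-∷⁻ ys₁ ys₂ (x∷xs⊆ys (there v∈xs)) (λ v≡x → All.lookup x∉xs v∈xs (sym v≡x))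

  unique-⊆-⊇⇒length≡ : ∀ {xs ys : List A} → Unique xs → Unique ys → xs ⊆ ys → ys ⊆ xs →
    length xs ≡ length ys
  unique-⊆-⊇⇒length≡ uxs uys xs⊆ys ys⊆xs =
    ≤-antisym (unique-⊆⇒length≤ uxs xs⊆ys) (unique-⊆⇒length≤ uys ys⊆xs)

  pigeonhole : DecidableEquality A → ∀ {xs ys : List A} → Unique xs → xs ⊆ ys →
    length ys ≤ length xs → ys ⊆ xs
  pigeonhole _≟_ {xs} u xs⊆ys ys≤xs {v} v∈ys with any? (v ≟_) xs
  ... | yes v∈xs = v∈xs
  ... | no v∉xs with ys₁ , ys₂ , refl ← ∈-∃++ v∈ys = contradiction ys≤xs (<⇒≱ (begin-strict
      length xs                 ≤⟨ unique-⊆⇒length≤ u xs⊆ys₁ys₂ ⟩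
      length (ys₁ ++ ys₂)       <⟨ n<1+n _ ⟩
      suc (length (ys₁ ++ ys₂)) ≡⟨ length-++-sucʳ ys₁ v ys₂ ⟨
      length (ys₁ ++ v ∷ ys₂)   ∎))
    where
    open ≤-Reasoning
    xs⊆ys₁ys₂ : xs ⊆ ys₁ ++ ys₂
    xs⊆ys₁ys₂ w∈xs = ∈-++-∷⁻ ys₁ ys₂ (xs⊆ys w∈xs) (λ w≡v → v∉xs (subst (_∈ xs) w≡v w∈xs))

  unique-map-injectiveOn : ∀ {B : Set} {f : A → B} {xs : List A} →
    (∀ {x y} → x ∈ xs → y ∈ xs → f x ≡ f y → x ≡ y) → Unique xs → Unique (map f xs)
  unique-map-injectiveOn inj [] = []
  unique-map-injectiveOn {f = f} inj (x∉xs ∷ u) =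
    head∉ ∷ unique-map-injectiveOn (λ x∈ y∈ → inj (there x∈) (there y∈)) u
    where
    head∉ : All (f _ ≢_) (map f _)
    head∉ = All.tabulate λ w∈ fx≡w → let (v , v∈xs , w≡fv) = ∈-map⁻ f w∈ in
      All.lookup x∉xs v∈xs (inj (here refl) (there v∈xs) (trans fx≡w w≡fv))

  count : (A → Bool) → List A → ℕ
  count P xs = length (filter (λ x → P x ≟ᵇ true) xs)

  count-cong : ∀ {P Q : A → Bool} → (∀ x → P x ≡ Q x) → ∀ xs → count P xs ≡ count Q xs
  count-cong P≡Q xs =
    cong length (filter-≐ _ _ ((λ {x} Px → trans (sym (P≡Q x)) Px) , (λ {x} Qx → trans (P≡Q x) Qx)) xs)

  count-bijection : (P Q : A → Bool) (f : A → A) {xs ys : List A} → Unique xs → Unique ys →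
    (∀ {x} → x ∈ xs → T (P x) → f x ∈ ys × T (Q (f x))) →
    (∀ {x y} → x ∈ xs → y ∈ xs → T (P x) → T (P y) → f x ≡ f y → x ≡ y) →
    (∀ {y} → y ∈ ys → T (Q y) → ∃[ x ] (x ∈ xs × T (P x) × f x ≡ y)) →
    count P xs ≡ count Q ys
  count-bijection P Q f {xs} {ys} uxs uys maps-to injective surjective = begin
    length Pxs          ≡⟨ length-map f Pxs ⟨
    length (map f Pxs)  ≡⟨ unique-⊆-⊇⇒length≡ unique-fPxs (filter⁺ Q? uys) fPxs⊆Qys Qys⊆fPxs ⟩
    length Qys          ∎
    where
    open ≡-Reasoning
    P? : Decidable (λ x → P x ≡ true)
    P? x = P x ≟ᵇ true
    Q? : Decidable (λ y → Q y ≡ true)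
    Q? y = Q y ≟ᵇ true
    Pxs Qys : List A
    Pxs = filter P? xs
    Qys = filter Q? ys

    ∈Pxs⁻ : ∀ {x} → x ∈ Pxs → x ∈ xs × T (P x)
    ∈Pxs⁻ x∈ = let (x∈xs , Px) = ∈-filter⁻ P? x∈ in x∈xs , Equivalence.from T-≡ Px

    unique-fPxs : Unique (map f Pxs)
    unique-fPxs = unique-map-injectiveOn
      (λ x∈ y∈ → injective (proj₁ (∈Pxs⁻ x∈)) (proj₁ (∈Pxs⁻ y∈)) (proj₂ (∈Pxs⁻ x∈)) (proj₂ (∈Pxs⁻ y∈)))
      (filter⁺ P? uxs)

    fPxs⊆Qys : map f Pxs ⊆ Qys
    fPxs⊆Qys w∈ with x , x∈ , refl ← ∈-map⁻ f w∈ =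
      let (fx∈ys , Qfx) = maps-to (proj₁ (∈Pxs⁻ x∈)) (proj₂ (∈Pxs⁻ x∈))
      in ∈-filter⁺ Q? fx∈ys (Equivalence.to T-≡ Qfx)

    Qys⊆fPxs : Qys ⊆ map f Pxs
    Qys⊆fPxs y∈ with y∈ys , Qy ← ∈-filter⁻ Q? y∈
                 with x , x∈xs , Px , refl ← surjective y∈ys (Equivalence.from T-≡ Qy) =
      ∈-map⁺ f (∈-filter⁺ P? x∈xs (Equivalence.to T-≡ Px))

oneTo : ℕ → List ℕ
oneTo n = map suc (upTo n)

length-oneTo : ∀ n → length (oneTo n) ≡ n
length-oneTo n = trans (length-map suc (upTo n)) (length-upTo n)

oneTo-unique : ∀ n → Unique (oneTo n)
oneTo-unique n = map⁺ suc-injective (upTo⁺ n)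

∈-oneTo⁻ : ∀ {n v} → v ∈ oneTo n → 0 < v × v ≤ n
∈-oneTo⁻ v∈ with i , i∈ , refl ← ∈-map⁻ suc v∈ = s≤s z≤n , ∈-upTo⁻ i∈

∈-oneTo⁺ : ∀ {n v} → 0 < v → v ≤ n → v ∈ oneTo n
∈-oneTo⁺ {v = suc i} _ v≤n = ∈-map⁺ suc (∈-upTo⁺ v≤n)

concatMap≡cartesianProductWith : ∀ {A B C : Set} (f : A → B → C) xs ys →
  concatMap (λ x → map (f x) ys) xs ≡ cartesianProductWith f xs ys
concatMap≡cartesianProductWith f []       ys = refl
concatMap≡cartesianProductWith f (x ∷ xs) ys =
  cong (map (f x) ys ++_) (concatMap≡cartesianProductWith f xs ys)

words-suc : ∀ k n → words (suc k) n ≡ cartesianProductWith _∷_ (oneTo n) (words k n)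
words-suc k n = concatMap≡cartesianProductWith _∷_ (oneTo n) (words k n)

∈-words⁻ : ∀ k n {w} → w ∈ words k n → length w ≡ k × w ⊆ oneTo n
∈-words⁻ zero    n (here refl) = refl , λ ()
∈-words⁻ (suc k) n w∈
  with x , w′ , x∈ , w′∈ , refl ← ∈-cartesianProductWith⁻ _∷_ (oneTo n) (words k n)
                                    (subst (_ ∈_) (words-suc k n) w∈)
  with length≡ , w′⊆ ← ∈-words⁻ k n w′∈ =
  cong suc length≡ , λ { (here refl) → x∈ ; (there v∈) → w′⊆ v∈ }

∈-words⁺ : ∀ k n {w} → length w ≡ k → w ⊆ oneTo n → w ∈ words k n
∈-words⁺ zero    n {[]}    refl _ = here refl
∈-words⁺ (suc k) n {x ∷ w} refl w⊆ = subst (_ ∈_) (sym (words-suc k n))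
  (∈-cartesianProductWith⁺ _∷_ (w⊆ (here refl)) (∈-words⁺ k n refl (w⊆ ∘ there)))

words-unique : ∀ k n → Unique (words k n)
words-unique zero    n = [] ∷ []
words-unique (suc k) n = subst Unique (sym (words-suc k n))
  (cartesianProductWith⁺ _∷_ ∷-injective (oneTo-unique n) (words-unique k n))

T-distinct⁻ : ∀ π → T (distinct π) → Unique π
T-distinct⁻ []       _ = []
T-distinct⁻ (x ∷ xs) t with x∉ , d ← Equivalence.to T-∧ t =
  All.tabulate (λ {y} y∈ x≡y → T-not⁻ x∉ (any⁺ (x ≡ᵇ_) (lose y∈ (≡⇒≡ᵇ x y x≡y))))
  ∷ T-distinct⁻ xs d

T-distinct⁺ : ∀ {π} → Unique π → T (distinct π)
T-distinct⁺ []               = tt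
T-distinct⁺ {x ∷ xs} (x∉ ∷ u) = T-not⁺ x∉xs & T-distinct⁺ u
  where
  x∉xs : ¬ T (any (x ≡ᵇ_) xs)
  x∉xs t with y , y∈ , x≡ᵇy ← find (any⁻ (x ≡ᵇ_) xs t) = All.lookup x∉ y∈ (≡ᵇ⇒≡ x y x≡ᵇy)

record IsPermutation (n : ℕ) (π : List ℕ) : Set where
  field
    length≡ : length π ≡ n
    ⊆oneTo  : π ⊆ oneTo n
    unique  : Unique π

  oneTo⊆ : oneTo n ⊆ π
  oneTo⊆ = pigeonhole _≟_ unique ⊆oneTo (≤-reflexive (trans (length-oneTo n) (sym length≡)))

IsPermutation-resp-length : ∀ {m n π} → m ≡ n → IsPermutation m π → IsPermutation n π
IsPermutation-resp-length refl p = p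

∈-S⁻ : ∀ {n π} → π ∈ S n → IsPermutation n π
∈-S⁻ {n} {π} π∈ with π∈words , d ← ∈-filter⁻ (λ w → distinct w ≟ᵇ true) {xs = words n n} π∈
                with length≡ , π⊆ ← ∈-words⁻ n n π∈words =
  record { length≡ = length≡ ; ⊆oneTo = π⊆ ; unique = T-distinct⁻ π (Equivalence.from T-≡ d) }

∈-S⁺ : ∀ {n π} → IsPermutation n π → π ∈ S n
∈-S⁺ {n} p = ∈-filter⁺ (λ w → distinct w ≟ᵇ true) (∈-words⁺ n n length≡ ⊆oneTo)
  (Equivalence.to T-≡ (T-distinct⁺ unique))
  where open IsPermutation p

S-unique : ∀ n → Unique (S n)
S-unique n = filter⁺ (λ w → distinct w ≟ᵇ true) (words-unique n n)

-- Lehmer codes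

below : ℕ → List ℕ → List ℕ
below t = filter (_<? t)

rank : ℕ → List ℕ → ℕ
rank t xs = length (below t xs)

rank-∷-< : ∀ {t y} s → y < t → rank t (y ∷ s) ≡ suc (rank t s)
rank-∷-< {t} s y<t = cong length (filter-accept (_<? t) {xs = s} y<t)

rank-∷-≥ : ∀ {t y} s → t ≤ y → rank t (y ∷ s) ≡ rank t s
rank-∷-≥ {t} s t≤y = cong length (filter-reject (_<? t) {xs = s} (≤⇒≯ t≤y))

rank-mono : ∀ {t t′} s → t ≤ t′ → rank t s ≤ rank t′ s
rank-mono []      _ = z≤n
rank-mono {t} {t′} (y ∷ s) t≤t′ with ih ← rank-mono s t≤t′ | y <? t | y <? t′
... | yes y<t | yes y<t′ rewrite rank-∷-< s y<t | rank-∷-< s y<t′ = s≤s ih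
... | yes y<t | no y≮t′  = contradiction (<-≤-trans y<t t≤t′) y≮t′
... | no y≮t  | yes y<t′ rewrite rank-∷-≥ s (≮⇒≥ y≮t) | rank-∷-< s y<t′ = m≤n⇒m≤1+n ih
... | no y≮t  | no y≮t′  rewrite rank-∷-≥ s (≮⇒≥ y≮t) | rank-∷-≥ s (≮⇒≥ y≮t′) = ih

rank-gap : ∀ {x y d} s → d ∈ s → x < d → d < y → suc (rank x s) ≤ rank y s
rank-gap {x} {y} (d ∷ s) (here refl) x<d d<y = begin
  suc (rank x (d ∷ s)) ≡⟨ cong suc (rank-∷-≥ s (<⇒≤ x<d)) ⟩
  suc (rank x s)       ≤⟨ s≤s (rank-mono s (<⇒≤ (<-trans x<d d<y))) ⟩
  suc (rank y s)       ≡⟨ rank-∷-< s d<y ⟨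
  rank y (d ∷ s)       ∎
  where open ≤-Reasoning
rank-gap {x} {y} (e ∷ s) (there d∈) x<d d<y with ih ← rank-gap s d∈ x<d d<y | e <? x | e <? y
... | yes e<x | yes e<y rewrite rank-∷-< s e<x | rank-∷-< s e<y = s≤s ih
... | yes e<x | no e≮y  = contradiction (<-trans e<x (<-trans x<d d<y)) e≮y
... | no e≮x  | yes e<y rewrite rank-∷-≥ s (≮⇒≥ e≮x) | rank-∷-< s e<y = m≤n⇒m≤1+n ih
... | no e≮x  | no e≮y  rewrite rank-∷-≥ s (≮⇒≥ e≮x) | rank-∷-≥ s (≮⇒≥ e≮y) = ih

rank-gap⁻ : ∀ {x y} s → x ∉ s → x < y → rank x s < rank y s → ∃[ d ] (d ∈ s × x < d × d < y)
rank-gap⁻ {x} {y} (e ∷ s) x∉ x<y r< with e <? x | e <? y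
... | yes e<x | yes e<y rewrite rank-∷-< s e<x | rank-∷-< s e<y =
  let (d , d∈ , x<d , d<y) = rank-gap⁻ s (x∉ ∘ there) x<y (≤-pred r<) in d , there d∈ , x<d , d<y
... | yes e<x | no e≮y  = contradiction (<-trans e<x x<y) e≮y
... | no e≮x  | yes e<y = e , here refl , ≤∧≢⇒< (≮⇒≥ e≮x) (λ x≡e → x∉ (here x≡e)) , e<y
... | no e≮x  | no e≮y  rewrite rank-∷-≥ s (≮⇒≥ e≮x) | rank-∷-≥ s (≮⇒≥ e≮y) =
  let (d , d∈ , x<d , d<y) = rank-gap⁻ s (x∉ ∘ there) x<y r< in d , there d∈ , x<d , d<y

punchIn : ℕ → ℕ → ℕ
punchIn t v with v <? t
... | yes _ = v
... | no  _ = suc v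

punchIn-<⇔ : ∀ {t u} → punchIn t u < t ⇔ u < t
punchIn-<⇔ {t} {u} with u <? t
... | yes u<t = mk⇔ (λ _ → u<t) (λ _ → u<t)
... | no u≮t  =
  mk⇔ (λ u+1<t → contradiction (<-trans (n<1+n u) u+1<t) u≮t) (λ u<t → contradiction u<t u≮t)

punchIn-≢ : ∀ t u → punchIn t u ≢ t
punchIn-≢ t u with u <? t
... | yes u<t = <⇒≢ u<t
... | no u≮t  = λ u+1≡t → u≮t (≤-reflexive u+1≡t)

punchIn-mono-< : ∀ t {u v} → u < v → punchIn t u < punchIn t v
punchIn-mono-< t {u} {v} u<v with u <? t | v <? t
... | yes _   | yes _   = u<v
... | yes _   | no _    = m<n⇒m<1+n u<v
... | no u≮t  | yes v<t = contradiction (<-trans u<v v<t) u≮t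
... | no _    | no _    = s≤s u<v

punchIn-<-⇔ : ∀ t {u v} → punchIn t u < punchIn t v ⇔ u < v
punchIn-<-⇔ t {u} {v} = mk⇔ reflect (punchIn-mono-< t)
  where
  reflect : punchIn t u < punchIn t v → u < v
  reflect pu<pv with <-cmp u v
  ... | tri< u<v _ _ = u<v
  ... | tri≈ _ refl _ = contradiction pu<pv (<-irrefl refl)
  ... | tri> _ _ v<u = contradiction pu<pv (<⇒≯ (punchIn-mono-< t v<u))

punchIn-injective : ∀ t {u v} → punchIn t u ≡ punchIn t v → u ≡ v
punchIn-injective t {u} {v} pu≡pv with <-cmp u v
... | tri< u<v _ _ = contradiction pu≡pv (<⇒≢ (punchIn-mono-< t u<v))
... | tri≈ _ u≡v _ = u≡v
... | tri> _ _ v<u = contradiction (sym pu≡pv) (<⇒≢ (punchIn-mono-< t v<u))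

punchIn-bounds : ∀ t {v} → v ≤ punchIn t v × punchIn t v ≤ suc v
punchIn-bounds t {v} with v <? t
... | yes _ = ≤-refl , n≤1+n v
... | no _  = n≤1+n v , ≤-refl

lehmer : List ℕ → List ℕ
lehmer []       = []
lehmer (x ∷ xs) = rank x xs ∷ lehmer xs

IsLehmerCode : List ℕ → Set
IsLehmerCode []       = ⊤
IsLehmerCode (c ∷ cs) = c ≤ length cs × IsLehmerCode cs

fromLehmer : List ℕ → List ℕ
fromLehmer []       = []
fromLehmer (c ∷ cs) = suc c ∷ map (punchIn (suc c)) (fromLehmer cs)

length-lehmer : ∀ π → length (lehmer π) ≡ length π
length-lehmer []       = refl
length-lehmer (x ∷ xs) = cong suc (length-lehmer xs)

lehmer-isLehmerCode : ∀ π → IsLehmerCode (lehmer π)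
lehmer-isLehmerCode []       = tt
lehmer-isLehmerCode (x ∷ xs) =
  subst (rank x xs ≤_) (sym (length-lehmer xs)) (length-filter (_<? x) xs) , lehmer-isLehmerCode xs

rank-map : ∀ {t t′} (f : ℕ → ℕ) → (∀ {u} → f u < t′ ⇔ u < t) → ∀ xs → rank t′ (map f xs) ≡ rank t xs
rank-map f f<⇔ [] = refl
rank-map {t} f f<⇔ (x ∷ xs) with x <? t
... | yes x<t rewrite rank-∷-< (map f xs) (Equivalence.from f<⇔ x<t) | rank-∷-< xs x<t =
  cong suc (rank-map f f<⇔ xs)
... | no x≮t rewrite rank-∷-≥ (map f xs) (≮⇒≥ (x≮t ∘ Equivalence.to f<⇔)) | rank-∷-≥ xs (≮⇒≥ x≮t) =
  rank-map f f<⇔ xs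

lehmer-map : (f : ℕ → ℕ) → (∀ {u v} → f u < f v ⇔ u < v) → ∀ xs → lehmer (map f xs) ≡ lehmer xs
lehmer-map f f<⇔ []       = refl
lehmer-map f f<⇔ (x ∷ xs) = cong₂ _∷_ (rank-map f f<⇔ xs) (lehmer-map f f<⇔ xs)

fromLehmer-isPermutation : ∀ c → IsLehmerCode c → IsPermutation (length c) (fromLehmer c)
fromLehmer-isPermutation []       _         = record { length≡ = refl ; ⊆oneTo = λ () ; unique = [] }
fromLehmer-isPermutation (c ∷ cs) (c≤ , cs-code) = record
  { length≡ = cong suc (trans (length-map _ D) length≡)
  ; ⊆oneTo  = λ { (here refl) → ∈-oneTo⁺ (s≤s z≤n) (s≤s c≤) ; (there w∈) → tail⊆ w∈ }
  ; unique  = All.tabulate head∉ ∷ map⁺ (punchIn-injective (suc c)) unique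
  }
  where
  D : List ℕ
  D = fromLehmer cs
  open IsPermutation (fromLehmer-isPermutation cs cs-code)
  tail⊆ : map (punchIn (suc c)) D ⊆ oneTo (suc (length cs))
  tail⊆ w∈ with v , v∈ , refl ← ∈-map⁻ _ w∈ with 0<v , v≤ ← ∈-oneTo⁻ (⊆oneTo v∈) =
    ∈-oneTo⁺ (<-≤-trans 0<v (proj₁ (punchIn-bounds (suc c))))
             (≤-trans (proj₂ (punchIn-bounds (suc c))) (s≤s v≤))
  head∉ : ∀ {w} → w ∈ map (punchIn (suc c)) D → suc c ≢ w
  head∉ w∈ c+1≡w with v , _ , refl ← ∈-map⁻ _ w∈ = punchIn-≢ (suc c) v (sym c+1≡w)

rank-of-permutation : ∀ {m c D} → IsPermutation m D → c ≤ m → rank (suc c) D ≡ c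
rank-of-permutation {m} {c} {D} p c≤m = begin
  length (below (suc c) D)
    ≡⟨ unique-⊆-⊇⇒length≡ (filter⁺ (_<? suc c) unique) (oneTo-unique c) below⊆ ⊆below ⟩
  length (oneTo c)         ≡⟨ length-oneTo c ⟩
  c                        ∎
  where
  open ≡-Reasoning
  open IsPermutation p
  below⊆ : below (suc c) D ⊆ oneTo c
  below⊆ v∈ with v∈D , v<c+1 ← ∈-filter⁻ (_<? suc c) v∈ =
    ∈-oneTo⁺ (proj₁ (∈-oneTo⁻ (⊆oneTo v∈D))) (≤-pred v<c+1)
  ⊆below : oneTo c ⊆ below (suc c) D
  ⊆below v∈ with 0<v , v≤c ← ∈-oneTo⁻ v∈ =
    ∈-filter⁺ (_<? suc c) (oneTo⊆ (∈-oneTo⁺ 0<v (≤-trans v≤c c≤m))) (s≤s v≤c)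

lehmer-fromLehmer : ∀ c → IsLehmerCode c → lehmer (fromLehmer c) ≡ c
lehmer-fromLehmer []       _               = refl
lehmer-fromLehmer (c ∷ cs) (c≤ , cs-code) = cong₂ _∷_
  (trans (rank-map (punchIn (suc c)) punchIn-<⇔ D)
         (rank-of-permutation (fromLehmer-isPermutation cs cs-code) c≤))
  (trans (lehmer-map (punchIn (suc c)) (punchIn-<-⇔ (suc c)) D) (lehmer-fromLehmer cs cs-code))
  where
  D : List ℕ
  D = fromLehmer cs

rank-<-of-⊆ : ∀ {x x′ τ τ′} → x < x′ → Unique (x ∷ τ) → x ∷ τ ⊆ x′ ∷ τ′ → suc (rank x τ) ≤ rank x′ τ′
rank-<-of-⊆ {x} {x′} {τ} {τ′} x<x′ (_ ∷ uτ) xτ⊆ =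
  unique-⊆⇒length≤ (All.tabulate x∉below ∷ filter⁺ (_<? x) uτ) sub
  where
  x∉below : ∀ {v} → v ∈ below x τ → x ≢ v
  x∉below v∈ x≡v = <⇒≢ (proj₂ (∈-filter⁻ (_<? x) {xs = τ} v∈)) (sym x≡v)
  sub : x ∷ below x τ ⊆ below x′ τ′
  sub (here refl) = ∈-filter⁺ (_<? x′) (∈-∷-≢ (xτ⊆ (here refl)) (<⇒≢ x<x′)) x<x′
  sub (there v∈) with v∈τ , v<x ← ∈-filter⁻ (_<? x) {xs = τ} v∈ =
    ∈-filter⁺ (_<? x′) (∈-∷-≢ (xτ⊆ (there v∈τ)) (<⇒≢ (<-trans v<x x<x′))) (<-trans v<x x<x′)

lehmer-injective : ∀ {π π′} → Unique π → Unique π′ → π ⊆ π′ → π′ ⊆ π → lehmer π ≡ lehmer π′ → π ≡ π′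
lehmer-injective {[]}     {[]}       _ _ _ _ _ = refl
lehmer-injective {x ∷ τ}  {x′ ∷ τ′} u@(x∉ ∷ uτ) u′@(x′∉ ∷ uτ′) π⊆ π⊇ eq with <-cmp x x′
... | tri< x<x′ _ _ = contradiction (∷-injectiveˡ eq) (<⇒≢ (rank-<-of-⊆ x<x′ u π⊆))
... | tri> _ _ x′<x = contradiction (sym (∷-injectiveˡ eq)) (<⇒≢ (rank-<-of-⊆ x′<x u′ π⊇))
... | tri≈ _ refl _ = cong (x ∷_) (lehmer-injective uτ uτ′
  (λ v∈ → ∈-∷-≢ (π⊆ (there v∈)) (λ v≡x → All.lookup x∉ v∈ (sym v≡x)))
  (λ v∈ → ∈-∷-≢ (π⊇ (there v∈)) (λ v≡x → All.lookup x′∉ v∈ (sym v≡x)))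
  (∷-injectiveʳ eq))

lehmer-injectiveOn : ∀ {n π π′} → IsPermutation n π → IsPermutation n π′ → lehmer π ≡ lehmer π′ → π ≡ π′
lehmer-injectiveOn p p′ =
  lehmer-injective (unique p) (unique p′) (oneTo⊆ p′ ∘ ⊆oneTo p) (oneTo⊆ p ∘ ⊆oneTo p′)
  where open IsPermutation

fromLehmer-lehmer : ∀ {n π} → IsPermutation n π → fromLehmer (lehmer π) ≡ π
fromLehmer-lehmer {π = π} p = lehmer-injectiveOn
  (IsPermutation-resp-length (trans (length-lehmer π) (IsPermutation.length≡ p))
    (fromLehmer-isPermutation (lehmer π) (lehmer-isLehmerCode π)))
  p (lehmer-fromLehmer (lehmer π) (lehmer-isLehmerCode π))

-- The bijection Φ on codes

NoChain : (ℕ → ℕ → Set) → (ℕ → ℕ → Set) → List ℕ → Set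
NoChain R S (a ∷ b ∷ c ∷ cs) = ¬ (R a b × S b c) × NoChain R S (b ∷ c ∷ cs)
NoChain R S _                = ⊤

NoChain-tail : ∀ {R S a} cs → NoChain R S (a ∷ cs) → NoChain R S cs
NoChain-tail []           _        = tt
NoChain-tail (_ ∷ [])     _        = tt
NoChain-tail (_ ∷ _ ∷ _) (_ , nc) = nc

Ascends : ℕ → ℕ → List ℕ → Set
Ascends a b []      = ⊥
Ascends a b (c ∷ _) = a ≤ b × b ≤ c

Ascends⇒≤ : ∀ {a b} t → Ascends a b t → a ≤ b
Ascends⇒≤ (_ ∷ _) (a≤b , _) = a≤b

ascends? : ∀ a b t → Dec (Ascends a b t)
ascends? a b []      = no λ ()
ascends? a b (c ∷ _) = a ≤? b ×-dec b ≤? c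

step : ℕ → ℕ → List ℕ → ℕ
step a b t with ascends? a b t
... | yes _ = a
... | no  _ = b

step-lower : ∀ {a b t} → Ascends a b t → step a b t ≡ a
step-lower {a} {b} {t} asc with ascends? a b t
... | yes _    = refl
... | no ¬asc = contradiction asc ¬asc

step-keep : ∀ {a b t} → ¬ Ascends a b t → step a b t ≡ b
step-keep {a} {b} {t} ¬asc with ascends? a b t
... | yes asc = contradiction asc ¬asc
... | no _    = refl

step-≤ : ∀ a b t → step a b t ≤ b
step-≤ a b t with ascends? a b t
... | yes asc = Ascends⇒≤ t asc
... | no _    = ≤-refl

step-≥ : ∀ {a b} t → a ≤ b → a ≤ step a b t
step-≥ {a} {b} t a≤b with ascends? a b t
... | yes _ = ≤-refl
... | no _  = a≤b

Φ-from : ℕ → List ℕ → List ℕ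
Φ-from a []      = []
Φ-from a (b ∷ t) = step a b t ∷ Φ-from (step a b t) t

Φ : List ℕ → List ℕ
Φ []      = []
Φ (a ∷ l) = a ∷ Φ-from a l

length-Φ-from : ∀ a l → length (Φ-from a l) ≡ length l
length-Φ-from a []      = refl
length-Φ-from a (b ∷ t) = cong suc (length-Φ-from (step a b t) t)

length-Φ : ∀ c → length (Φ c) ≡ length c
length-Φ []      = refl
length-Φ (a ∷ l) = cong suc (length-Φ-from a l)

Φ-from-isLehmerCode : ∀ a l → IsLehmerCode (a ∷ l) → IsLehmerCode (a ∷ Φ-from a l)
Φ-from-isLehmerCode a []      a-code             = a-code
Φ-from-isLehmerCode a (b ∷ t) (a≤ , b≤ , t-code) =
  subst (a ≤_) (sym (length-Φ-from a (b ∷ t))) a≤ ,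
  Φ-from-isLehmerCode (step a b t) t (≤-trans (step-≤ a b t) b≤ , t-code)

Φ-isLehmerCode : ∀ c → IsLehmerCode c → IsLehmerCode (Φ c)
Φ-isLehmerCode []      _ = tt
Φ-isLehmerCode (a ∷ l)   = Φ-from-isLehmerCode a l

pinch : ∀ {a b c r} → a ≤ b → b ≤ c → NoChain _≤_ _<_ (a ∷ b ∷ c ∷ r) → b ≡ c
pinch a≤b b≤c (¬a≤b<c , _) = ≤-antisym b≤c (≮⇒≥ λ b<c → ¬a≤b<c (a≤b , b<c))

NoChain-step : ∀ a b t → NoChain _≤_ _<_ (a ∷ b ∷ t) → NoChain _≤_ _<_ (step a b t ∷ t)
NoChain-step a b t nc with ascends? a b t
... | no _ = NoChain-tail (b ∷ t) nc
NoChain-step a b (c ∷ []) nc | yes _ = tt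
NoChain-step a b (c ∷ d ∷ r) nc@(_ , ¬b≤c<d , nc′) | yes (a≤b , b≤c) with refl ← pinch a≤b b≤c nc =
  (λ (_ , c<d) → ¬b≤c<d (≤-refl , c<d)) , nc′

step-no<≤ : ∀ a b c r → let s = step a b (c ∷ r) in ¬ (a < s × s ≤ step s c r)
step-no<≤ a b c r with ascends? a b (c ∷ r)
... | yes _ = λ (a<a , _) → <-irrefl refl a<a
... | no ¬a≤b≤c with ascends? b c r
...   | yes asc = λ (a<b , _) → ¬a≤b≤c (<⇒≤ a<b , Ascends⇒≤ r asc)
...   | no _          = λ (a<b , b≤c) → ¬a≤b≤c (<⇒≤ a<b , b≤c)

Φ-from-noChain : ∀ a l → NoChain _≤_ _<_ (a ∷ l) → NoChain _<_ _≤_ (a ∷ Φ-from a l)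
Φ-from-noChain a []          _  = tt
Φ-from-noChain a (b ∷ [])    _  = tt
Φ-from-noChain a (b ∷ c ∷ r) nc =
  step-no<≤ a b c r , Φ-from-noChain (step a b (c ∷ r)) (c ∷ r) (NoChain-step a b (c ∷ r) nc)

Φ-noChain : ∀ c → NoChain _≤_ _<_ c → NoChain _<_ _≤_ (Φ c)
Φ-noChain []      _ = tt
Φ-noChain (a ∷ l)   = Φ-from-noChain a l

step-injective : ∀ {a b b′ t} → NoChain _≤_ _<_ (a ∷ b ∷ t) → NoChain _≤_ _<_ (a ∷ b′ ∷ t) →
  step a b t ≡ step a b′ t → b ≡ b′
step-injective {a} {b} {b′} {t} nc nc′ s≡s′ with ascends? a b t | ascends? a b′ t
... | no _  | no _  = s≡s′
step-injective {t = c ∷ r} nc nc′ s≡s′ | yes (a≤b , b≤c) | yes (a≤b′ , b′≤c) =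
  trans (pinch a≤b b≤c nc) (sym (pinch a≤b′ b′≤c nc′))
step-injective {t = c ∷ r} nc nc′ refl | yes (a≤b , b≤c) | no ¬asc′ =
  contradiction (≤-refl , ≤-trans a≤b b≤c) ¬asc′
step-injective {t = c ∷ r} nc nc′ refl | no ¬asc | yes (a≤b′ , b′≤c) =
  contradiction (≤-refl , ≤-trans a≤b′ b′≤c) ¬asc

Φ-from-injective : ∀ {a a′ l l′} → NoChain _≤_ _<_ (a ∷ l) → NoChain _≤_ _<_ (a′ ∷ l′) →
  a ≡ a′ → Φ-from a l ≡ Φ-from a′ l′ → l ≡ l′
Φ-from-injective {l = []}    {[]}      _  _   _    _  = refl
Φ-from-injective {a} {l = b ∷ t} {b′ ∷ t′} nc nc′ refl eq
  with refl ← Φ-from-injective (NoChain-step a b t nc) (NoChain-step a b′ t′ nc′)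
                                (∷-injectiveˡ eq) (∷-injectiveʳ eq)
  = cong (_∷ t) (step-injective nc nc′ (∷-injectiveˡ eq))

Φ-injective : ∀ {c c′} → NoChain _≤_ _<_ c → NoChain _≤_ _<_ c′ → Φ c ≡ Φ c′ → c ≡ c′
Φ-injective {[]}    {[]}      _  _   _  = refl
Φ-injective {a ∷ l} {a′ ∷ l′} nc nc′ eq =
  cong₂ _∷_ (∷-injectiveˡ eq) (Φ-from-injective nc nc′ (∷-injectiveˡ eq) (∷-injectiveʳ eq))

NoChain-∷ : ∀ {a b} t → ¬ Ascends a b t → NoChain _≤_ _<_ (b ∷ t) → NoChain _≤_ _<_ (a ∷ b ∷ t)
NoChain-∷ []      _    _  = tt
NoChain-∷ (c ∷ _) ¬asc nc = (λ (a≤b , b<c) → ¬asc (a≤b , <⇒≤ b<c)) , nc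

NoChain-repeat : ∀ {b c} r → b ≤ c → NoChain _≤_ _<_ (b ∷ c ∷ r) → NoChain _≤_ _<_ (b ∷ c ∷ c ∷ r)
NoChain-repeat []      _   _               = (λ (_ , c<c) → <-irrefl refl c<c) , tt
NoChain-repeat (d ∷ _) b≤c (¬b≤c<d , nc) =
  (λ (_ , c<c) → <-irrefl refl c<c) , (λ (_ , c<d) → ¬b≤c<d (b≤c , c<d)) , nc

Φ-from-surjective : ∀ a e → NoChain _<_ _≤_ (a ∷ e) → IsLehmerCode (a ∷ e) →
  ∃[ l ] (Φ-from a l ≡ e × NoChain _≤_ _<_ (a ∷ l) × IsLehmerCode (a ∷ l))
Φ-from-surjective a []       _  a-code = [] , refl , tt , a-code
Φ-from-surjective a (e₁ ∷ e) nc (a≤ , e-code) with Φ-from-surjective e₁ e (NoChain-tail (e₁ ∷ e) nc) e-code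
... | l , refl , nc′ , l-code with ascends? a e₁ l
...   | no ¬asc =
  e₁ ∷ l , cong (λ s → s ∷ Φ-from s l) (step-keep ¬asc) , NoChain-∷ l ¬asc nc′ ,
  subst (a ≤_) (cong suc (length-Φ-from e₁ l)) a≤ , l-code
Φ-from-surjective a (e₁ ∷ _) (¬a<e₁≤e₂ , _) (a≤ , _)
  | c ∷ r , refl , nc′ , (_ , c≤ , r-code) | yes (a≤e₁ , e₁≤c)
  with refl ← ≤-antisym a≤e₁ (≮⇒≥ λ a<e₁ → ¬a<e₁≤e₂ (a<e₁ , step-≥ r e₁≤c)) =
  c ∷ c ∷ r , cong (λ s → s ∷ Φ-from s (c ∷ r)) (step-lower (e₁≤c , ≤-refl)) ,
  NoChain-repeat r e₁≤c nc′ ,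
  subst (a ≤_) (cong suc (length-Φ-from a (c ∷ r))) a≤ , m≤n⇒m≤1+n c≤ , c≤ , r-code

Φ-surjective : ∀ e → NoChain _<_ _≤_ e → IsLehmerCode e →
  ∃[ c ] (Φ c ≡ e × NoChain _≤_ _<_ c × IsLehmerCode c)
Φ-surjective []      _ _ = [] , refl , tt , tt
Φ-surjective (a ∷ e) nc e-code with l , Φ-from≡ , nc′ , l-code ← Φ-from-surjective a e nc e-code =
  a ∷ l , cong (a ∷_) Φ-from≡ , nc′ , l-code

data Occurs (R : ℕ → ℕ → ℕ → ℕ → Set) : List ℕ → Set where
  here  : ∀ {x y z d r} → d ∈ r → R x y z d → Occurs R (x ∷ y ∷ z ∷ r)
  there : ∀ {w π} → Occurs R π → Occurs R (w ∷ π)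

Occurs-map : ∀ {R R′ : ℕ → ℕ → ℕ → ℕ → Set} → (∀ {x y z d} → R x y z d → R′ x y z d) →
  ∀ {π} → Occurs R π → Occurs R′ π
Occurs-map f (here d∈ r) = here d∈ (f r)
Occurs-map f (there o)   = there (Occurs-map f o)

Occurs-cong : ∀ {R R′ : ℕ → ℕ → ℕ → ℕ → Set} → (∀ {x y z d} → R x y z d ⇔ R′ x y z d) →
  ∀ {π} → Occurs R π ⇔ Occurs R′ π
Occurs-cong R⇔R′ = mk⇔ (Occurs-map (Equivalence.to R⇔R′)) (Occurs-map (Equivalence.from R⇔R′))

at-∈ : ∀ r k → suc k ≤ length r → at r (suc k) ∈ r
at-∈ (x ∷ xs) zero    _           = here refl
at-∈ (x ∷ xs) (suc k) (s≤s k<|xs|) = there (at-∈ xs k k<|xs|)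

∈⇒at : ∀ {d : ℕ} {r} → d ∈ r → ∃[ k ] (suc k ≤ length r × at r (suc k) ≡ d)
∈⇒at (here refl) = zero , s≤s z≤n , refl
∈⇒at (there d∈) with k , k< , at≡ ← ∈⇒at d∈ = suc k , s≤s k< , at≡

-- Positions are 1-based, as in `at`: the adjacent letters sit at 1 + i, 2 + i and 3 + i.
OccursAt : (ℕ → ℕ → ℕ → ℕ → Set) → List ℕ → ℕ → ℕ → Set
OccursAt R π i l = 3 + i < l × l ≤ length π × R (at π (1 + i)) (at π (2 + i)) (at π (3 + i)) (at π l)

Occurs⇒OccursAt : ∀ {R π} → Occurs R π → ∃[ i ] ∃[ l ] OccursAt R π i l
Occurs⇒OccursAt (here {r = r} d∈ Rxyzd) with k , k< , refl ← ∈⇒at d∈ =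
  0 , 4 + k , s≤s (s≤s (s≤s (s≤s z≤n))) , s≤s (s≤s (s≤s k<)) , Rxyzd
Occurs⇒OccursAt (there o) with i , suc l , 3+i<l+1 , l+1≤ , R-at ← Occurs⇒OccursAt o =
  suc i , suc (suc l) , s≤s 3+i<l+1 , s≤s l+1≤ , R-at

OccursAt⇒Occurs : ∀ {R} π i l → OccursAt R π i l → Occurs R π
OccursAt⇒Occurs (x ∷ y ∷ z ∷ r) zero _ (s≤s (s≤s (s≤s (s≤s z≤n))) , s≤s (s≤s (s≤s k<)) , R-at) =
  here (at-∈ r _ k<) R-at
OccursAt⇒Occurs (w ∷ π) (suc i) (suc l) (s≤s 3+i<l@(s≤s _) , s≤s l≤ , R-at) =
  there (OccursAt⇒Occurs π i l (3+i<l , l≤ , R-at))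

T-adjacent : ∀ {i j k l} →
  T (indicesOK (true ∷ true ∷ false ∷ []) (i ∷ j ∷ k ∷ l ∷ [])) ⇔ (j ≡ suc i × k ≡ suc j × k < l)
T-adjacent {i} {j} {k} {l} = mk⇔ to from
  where
  to : T (indicesOK (true ∷ true ∷ false ∷ []) (i ∷ j ∷ k ∷ l ∷ [])) → j ≡ suc i × k ≡ suc j × k < l
  to t = let (i+1≡j , t′) = Equivalence.to T-∧ t
             (j+1≡k , t″) = Equivalence.to T-∧ t′
         in sym (≡ᵇ⇒≡ _ _ i+1≡j) , sym (≡ᵇ⇒≡ _ _ j+1≡k) , <ᵇ⇒< k l (proj₁ (Equivalence.to T-∧ t″))
  from : j ≡ suc i × k ≡ suc j × k < l → T (indicesOK (true ∷ true ∷ false ∷ []) (i ∷ j ∷ k ∷ l ∷ []))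
  from (refl , refl , k<l) = ≡⇒≡ᵇ j j refl & ≡⇒≡ᵇ k k refl & <⇒<ᵇ k<l & tt

contains-abc-d : ∀ {a b c d} π →
  T (contains ((a ∷ b ∷ c ∷ []) ∷ (d ∷ []) ∷ []) π) ⇔
  Occurs (λ x y z w → T (orderIso (a ∷ b ∷ c ∷ d ∷ []) (x ∷ y ∷ z ∷ w ∷ []))) π
contains-abc-d {a} {b} {c} {d} π = mk⇔ to from
  where
  ρ : List ℕ
  ρ = a ∷ b ∷ c ∷ d ∷ []
  Iso : ℕ → ℕ → ℕ → ℕ → Set
  Iso x y z w = T (orderIso ρ (x ∷ y ∷ z ∷ w ∷ []))
  matches : List ℕ → Bool
  matches is = indicesOK (true ∷ true ∷ false ∷ []) is ∧ orderIso ρ (map (at π) is)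

  occurrence : ∀ is → length is ≡ 4 × is ⊆ oneTo (length π) → T (matches is) → Occurs Iso π
  occurrence (zero ∷ _ ∷ _ ∷ _ ∷ [])  (refl , is⊆) _ =
    contradiction (proj₁ (∈-oneTo⁻ (is⊆ (here refl)))) λ ()
  occurrence (suc i ∷ j ∷ k ∷ l ∷ []) (refl , is⊆) match
    with adjacent , iso ← Equivalence.to T-∧ match
    with refl , refl , k<l ← Equivalence.to (T-adjacent {suc i} {j} {k} {l}) adjacent =
    OccursAt⇒Occurs π i l (k<l , proj₂ (∈-oneTo⁻ (is⊆ (there (there (there (here refl)))))) , iso)

  to : T (any matches (words 4 (length π))) → Occurs Iso π
  to t with is , is∈ , match ← find (any⁻ matches _ t) = occurrence is (∈-words⁻ 4 _ is∈) match

  from : Occurs Iso π → T (any matches (words 4 (length π)))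
  from o with i , l , 3+i<l , l≤ , iso ← Occurs⇒OccursAt o =
    any⁺ matches (lose (∈-words⁺ 4 _ refl is⊆)
      (Equivalence.from (T-adjacent {1 + i} {2 + i} {3 + i} {l}) (refl , refl , 3+i<l) & iso))
    where
    position : ∀ {v} → 0 < v → v ≤ l → v ∈ oneTo (length π)
    position 0<v v≤l = ∈-oneTo⁺ 0<v (≤-trans v≤l l≤)
    is⊆ : (1 + i ∷ 2 + i ∷ 3 + i ∷ l ∷ []) ⊆ oneTo (length π)
    is⊆ (here refl)                         = position (s≤s z≤n) (≤-trans (m≤n+m (1 + i) 2) (<⇒≤ 3+i<l))
    is⊆ (there (here refl))                 = position (s≤s z≤n) (≤-trans (n≤1+n (2 + i)) (<⇒≤ 3+i<l))
    is⊆ (there (there (here refl)))         = position (s≤s z≤n) (<⇒≤ 3+i<l)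
    is⊆ (there (there (there (here refl)))) = position (<-≤-trans (s≤s z≤n) 3+i<l) ≤-refl

orderIso-<ᵇ : ∀ ρ σ {p q p′ q′} → T (orderIso ρ σ) → (p , q) ∈ zip ρ σ → (p′ , q′) ∈ zip ρ σ →
  T (p <ᵇ p′) → T (q <ᵇ q′)
orderIso-<ᵇ ρ σ {p} {q} {p′} {q′} t m m′ = subst T agree
  where
  agree : (p <ᵇ p′) ≡ (q <ᵇ q′)
  agree with p <ᵇ p′ | q <ᵇ q′ | all²-lookup (zip ρ σ) t m m′
  ... | true  | true  | _  = refl
  ... | false | false | _  = refl
  ... | true  | false | ()
  ... | false | true  | ()

≥⇒T-not-<ᵇ : ∀ {u v} → v ≤ u → T (not (u <ᵇ v))
≥⇒T-not-<ᵇ v≤u = T-not⁺ (λ u<ᵇv → ≤⇒≯ v≤u (<ᵇ⇒< _ _ u<ᵇv))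

Is124-3 Is134-2 : ℕ → ℕ → ℕ → ℕ → Set
Is124-3 x y z d = x < y × y < d × d < z
Is134-2 x y z d = x < d × d < y × y < z

orderIso-1243 : ∀ {x y z w} → T (orderIso (1 ∷ 2 ∷ 4 ∷ 3 ∷ []) (x ∷ y ∷ z ∷ w ∷ [])) ⇔ Is124-3 x y z w
orderIso-1243 {x} {y} {z} {w} = mk⇔ to from
  where
  ρ σ : List ℕ
  ρ = 1 ∷ 2 ∷ 4 ∷ 3 ∷ []
  σ = x ∷ y ∷ z ∷ w ∷ []
  to : T (orderIso ρ σ) → Is124-3 x y z w
  to t = <ᵇ⇒< x y (orderIso-<ᵇ ρ σ t (∈-lookup (# 0)) (∈-lookup (# 1)) tt) ,
         <ᵇ⇒< y w (orderIso-<ᵇ ρ σ t (∈-lookup (# 1)) (∈-lookup (# 3)) tt) ,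
         <ᵇ⇒< w z (orderIso-<ᵇ ρ σ t (∈-lookup (# 3)) (∈-lookup (# 2)) tt)
  from : Is124-3 x y z w → T (orderIso ρ σ)
  from (x<y , y<w , w<z) =
        (ge (≤-refl {x}) & lt x<y & lt x<z & lt x<w & tt)
    & (ge (<⇒≤ x<y) & ge (≤-refl {y}) & lt y<z & lt y<w & tt)
    & (ge (<⇒≤ x<z) & ge (<⇒≤ y<z) & ge (≤-refl {z}) & ge (<⇒≤ w<z) & tt)
    & (ge (<⇒≤ x<w) & ge (<⇒≤ y<w) & lt w<z & ge (≤-refl {w}) & tt)
    & tt
    where
    lt : ∀ {u v} → u < v → T (u <ᵇ v)
    lt = <⇒<ᵇ
    ge : ∀ {u v} → v ≤ u → T (not (u <ᵇ v))
    ge = ≥⇒T-not-<ᵇ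
    x<w : x < w
    x<w = <-trans x<y y<w
    y<z : y < z
    y<z = <-trans y<w w<z
    x<z : x < z
    x<z = <-trans x<y y<z

orderIso-1342 : ∀ {x y z w} → T (orderIso (1 ∷ 3 ∷ 4 ∷ 2 ∷ []) (x ∷ y ∷ z ∷ w ∷ [])) ⇔ Is134-2 x y z w
orderIso-1342 {x} {y} {z} {w} = mk⇔ to from
  where
  ρ σ : List ℕ
  ρ = 1 ∷ 3 ∷ 4 ∷ 2 ∷ []
  σ = x ∷ y ∷ z ∷ w ∷ []
  to : T (orderIso ρ σ) → Is134-2 x y z w
  to t = <ᵇ⇒< x w (orderIso-<ᵇ ρ σ t (∈-lookup (# 0)) (∈-lookup (# 3)) tt) ,
         <ᵇ⇒< w y (orderIso-<ᵇ ρ σ t (∈-lookup (# 3)) (∈-lookup (# 1)) tt) ,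
         <ᵇ⇒< y z (orderIso-<ᵇ ρ σ t (∈-lookup (# 1)) (∈-lookup (# 2)) tt)
  from : Is134-2 x y z w → T (orderIso ρ σ)
  from (x<w , w<y , y<z) =
        (ge (≤-refl {x}) & lt x<y & lt x<z & lt x<w & tt)
    & (ge (<⇒≤ x<y) & ge (≤-refl {y}) & lt y<z & ge (<⇒≤ w<y) & tt)
    & (ge (<⇒≤ x<z) & ge (<⇒≤ y<z) & ge (≤-refl {z}) & ge (<⇒≤ w<z) & tt)
    & (ge (<⇒≤ x<w) & lt w<y & lt w<z & ge (≤-refl {w}) & tt)
    & tt
    where
    lt : ∀ {u v} → u < v → T (u <ᵇ v)
    lt = <⇒<ᵇ
    ge : ∀ {u v} → v ≤ u → T (not (u <ᵇ v))
    ge = ≥⇒T-not-<ᵇ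
    x<y : x < y
    x<y = <-trans x<w w<y
    w<z : w < z
    w<z = <-trans w<y y<z
    x<z : x < z
    x<z = <-trans x<y y<z

-- Avoidance read off the Lehmer code

rank-∷-descent : ∀ {x y} s → y < x → suc (rank y s) ≤ rank x (y ∷ s)
rank-∷-descent {x} {y} s y<x = begin
  suc (rank y s) ≤⟨ s≤s (rank-mono s (<⇒≤ y<x)) ⟩
  suc (rank x s) ≡⟨ rank-∷-< s y<x ⟨
  rank x (y ∷ s) ∎
  where open ≤-Reasoning

rank-∷-≤⇒< : ∀ {x y} s → x ≢ y → rank x (y ∷ s) ≤ rank y s → x < y
rank-∷-≤⇒< {x} {y} s x≢y r≤ with <-cmp x y
... | tri< x<y _ _ = x<y
... | tri≈ _ x≡y _ = contradiction x≡y x≢y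
... | tri> _ _ y<x = contradiction (≤-trans (rank-∷-descent s y<x) r≤) (<-irrefl refl)

lehmer-124-3 : ∀ {x y z r} → Unique (x ∷ y ∷ z ∷ r) →
  (rank x (y ∷ z ∷ r) ≤ rank y (z ∷ r) × rank y (z ∷ r) < rank z r) ⇔ (∃[ d ] (d ∈ r × Is124-3 x y z d))
lehmer-124-3 {x} {y} {z} {r} (x∉ ∷ y∉ ∷ _) = mk⇔ to from
  where
  cx cy cz : ℕ
  cx = rank x (y ∷ z ∷ r)
  cy = rank y (z ∷ r)
  cz = rank z r

  to : cx ≤ cy × cy < cz → ∃[ d ] (d ∈ r × Is124-3 x y z d)
  to (cx≤cy , cy<cz)
    with y<z ← rank-∷-≤⇒< r (All.lookup y∉ (here refl)) (<⇒≤ cy<cz)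
    with d , d∈ , y<d , d<z ← rank-gap⁻ r (λ y∈r → All.lookup y∉ (there y∈r) refl) y<z
                                (subst (_< cz) (rank-∷-≥ r (<⇒≤ y<z)) cy<cz) =
    d , d∈ , rank-∷-≤⇒< (z ∷ r) (All.lookup x∉ (here refl)) cx≤cy , y<d , d<z
  from : ∃[ d ] (d ∈ r × Is124-3 x y z d) → cx ≤ cy × cy < cz
  from (d , d∈ , x<y , y<d , d<z) =
    subst (_≤ cy) (sym (rank-∷-≥ (z ∷ r) (<⇒≤ x<y))) (rank-mono (z ∷ r) (<⇒≤ x<y)) ,
    subst (_< cz) (sym (rank-∷-≥ r (<⇒≤ (<-trans y<d d<z)))) (rank-gap r d∈ y<d d<z)

lehmer-134-2 : ∀ {x y z r} → Unique (x ∷ y ∷ z ∷ r) →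
  (rank x (y ∷ z ∷ r) < rank y (z ∷ r) × rank y (z ∷ r) ≤ rank z r) ⇔ (∃[ d ] (d ∈ r × Is134-2 x y z d))
lehmer-134-2 {x} {y} {z} {r} (x∉ ∷ y∉ ∷ _) = mk⇔ to from
  where
  cx cy cz : ℕ
  cx = rank x (y ∷ z ∷ r)
  cy = rank y (z ∷ r)
  cz = rank z r

  to : cx < cy × cy ≤ cz → ∃[ d ] (d ∈ r × Is134-2 x y z d)
  to (cx<cy , cy≤cz)
    with x<y ← rank-∷-≤⇒< (z ∷ r) (All.lookup x∉ (here refl)) (<⇒≤ cx<cy)
    with y<z ← rank-∷-≤⇒< r (All.lookup y∉ (here refl)) cy≤cz
    with d , d∈zr , x<d , d<y ← rank-gap⁻ (z ∷ r) (λ x∈zr → All.lookup x∉ (there x∈zr) refl) x<y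
                                  (subst (_< cy) (rank-∷-≥ (z ∷ r) (<⇒≤ x<y)) cx<cy) =
    d , ∈-∷-≢ d∈zr (<⇒≢ (<-trans d<y y<z)) , x<d , d<y , y<z
  from : ∃[ d ] (d ∈ r × Is134-2 x y z d) → cx < cy × cy ≤ cz
  from (d , d∈ , x<d , d<y , y<z) =
    subst (_< cy) (sym (rank-∷-≥ (z ∷ r) (<⇒≤ (<-trans x<d d<y)))) (rank-gap (z ∷ r) (there d∈) x<d d<y) ,
    subst (_≤ cz) (sym (rank-∷-≥ r (<⇒≤ y<z))) (rank-mono r (<⇒≤ y<z))

module _ {R S : ℕ → ℕ → Set} {Q : ℕ → ℕ → ℕ → ℕ → Set}
  (local : ∀ {x y z r} → Unique (x ∷ y ∷ z ∷ r) →
           (R (rank x (y ∷ z ∷ r)) (rank y (z ∷ r)) × S (rank y (z ∷ r)) (rank z r)) ⇔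
           (∃[ d ] (d ∈ r × Q x y z d)))
  where

  NoChain-lehmer⇔¬Occurs : ∀ {π} → Unique π → NoChain R S (lehmer π) ⇔ (¬ Occurs Q π)
  NoChain-lehmer⇔¬Occurs {π} u = mk⇔ (noChain⇒¬occurs u) (¬occurs⇒noChain π u)
    where
    noChain⇒¬occurs : ∀ {π} → Unique π → NoChain R S (lehmer π) → ¬ Occurs Q π
    noChain⇒¬occurs u (¬chain , _) (here d∈ q) = ¬chain (Equivalence.from (local u) (_ , d∈ , q))
    noChain⇒¬occurs {w ∷ π} (_ ∷ u) nc (there o) = noChain⇒¬occurs u (NoChain-tail (lehmer π) nc) o

    ¬occurs⇒noChain : ∀ π → Unique π → ¬ Occurs Q π → NoChain R S (lehmer π)
    ¬occurs⇒noChain (x ∷ y ∷ z ∷ r) u@(_ ∷ u′) ¬o =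
      (λ chain → let (d , d∈ , q) = Equivalence.to (local u) chain in ¬o (here d∈ q)) ,
      ¬occurs⇒noChain (y ∷ z ∷ r) u′ (¬o ∘ there)
    ¬occurs⇒noChain []          _ _ = tt
    ¬occurs⇒noChain (_ ∷ [])     _ _ = tt
    ¬occurs⇒noChain (_ ∷ _ ∷ []) _ _ = tt

T-avoids⇔¬Occurs : ∀ {p π} {R : ℕ → ℕ → ℕ → ℕ → Set} → T (contains p π) ⇔ Occurs R π →
  T (avoids p π) ⇔ (¬ Occurs R π)
T-avoids⇔¬Occurs contains⇔ =
  mk⇔ (λ t o → T-not⁻ t (Equivalence.from contains⇔ o)) (λ ¬o → T-not⁺ (¬o ∘ Equivalence.to contains⇔))

avoids-124-3⇔NoChain : ∀ {π} → Unique π → T (avoids p124-3 π) ⇔ NoChain _≤_ _<_ (lehmer π)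
avoids-124-3⇔NoChain {π} u =
  ⇔-trans (T-avoids⇔¬Occurs {p124-3}
            (⇔-trans (contains-abc-d {1} {2} {4} {3} π) (Occurs-cong orderIso-1243)))
          (⇔-sym (NoChain-lehmer⇔¬Occurs lehmer-124-3 u))

avoids-134-2⇔NoChain : ∀ {π} → Unique π → T (avoids p134-2 π) ⇔ NoChain _<_ _≤_ (lehmer π)
avoids-134-2⇔NoChain {π} u =
  ⇔-trans (T-avoids⇔¬Occurs {p134-2}
            (⇔-trans (contains-abc-d {1} {3} {4} {2} π) (Occurs-cong orderIso-1342)))
          (⇔-sym (NoChain-lehmer⇔¬Occurs lehmer-134-2 u))

Ψ : List ℕ → List ℕ
Ψ π = fromLehmer (Φ (lehmer π))

module _ {n π} (p : IsPermutation n π) where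
  private
    Φc-code : IsLehmerCode (Φ (lehmer π))
    Φc-code = Φ-isLehmerCode (lehmer π) (lehmer-isLehmerCode π)

  Ψ-isPermutation : IsPermutation n (Ψ π)
  Ψ-isPermutation = IsPermutation-resp-length
    (trans (length-Φ (lehmer π)) (trans (length-lehmer π) (IsPermutation.length≡ p)))
    (fromLehmer-isPermutation (Φ (lehmer π)) Φc-code)

  lehmer-Ψ : lehmer (Ψ π) ≡ Φ (lehmer π)
  lehmer-Ψ = lehmer-fromLehmer (Φ (lehmer π)) Φc-code

  Ψ-avoids : T (avoids p124-3 π) → T (avoids p134-2 (Ψ π))
  Ψ-avoids av = Equivalence.from (avoids-134-2⇔NoChain (IsPermutation.unique Ψ-isPermutation))
    (subst (NoChain _<_ _≤_) (sym lehmer-Ψ)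
      (Φ-noChain (lehmer π) (Equivalence.to (avoids-124-3⇔NoChain (IsPermutation.unique p)) av)))

-- The first letter of fromLehmer (e ∷ _) is 1 + e, and Φ keeps the first entry of a code.
Ψ-firstIs : ∀ {n π} a → IsPermutation n π → firstIs a (Ψ π) ≡ firstIs a π
Ψ-firstIs {π = []}    a _ = refl
Ψ-firstIs {π = x ∷ τ} a p = cong (firstIs a) (fromLehmer-lehmer p)

Ψ-injective : ∀ {n π π′} → IsPermutation n π → IsPermutation n π′ →
  T (avoids p124-3 π) → T (avoids p124-3 π′) → Ψ π ≡ Ψ π′ → π ≡ π′
Ψ-injective {n} {π} {π′} p p′ av av′ Ψπ≡Ψπ′ =
  lehmer-injectiveOn p p′ (Φ-injective (noChain p av) (noChain p′ av′) (begin
  Φ (lehmer π)   ≡⟨ lehmer-Ψ p ⟨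
  lehmer (Ψ π)   ≡⟨ cong lehmer Ψπ≡Ψπ′ ⟩
  lehmer (Ψ π′)  ≡⟨ lehmer-Ψ p′ ⟩
  Φ (lehmer π′)  ∎))
  where
  open ≡-Reasoning
  noChain : ∀ {σ} → IsPermutation n σ → T (avoids p124-3 σ) → NoChain _≤_ _<_ (lehmer σ)
  noChain q = Equivalence.to (avoids-124-3⇔NoChain (IsPermutation.unique q))

Ψ-surjective : ∀ {n σ} → IsPermutation n σ → T (avoids p134-2 σ) →
  ∃[ π ] (IsPermutation n π × T (avoids p124-3 π) × Ψ π ≡ σ)
Ψ-surjective {n} {σ} q av
  with c , Φc≡ , nc , c-code ← Φ-surjective (lehmer σ)
                                 (Equivalence.to (avoids-134-2⇔NoChain (IsPermutation.unique q)) av)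
                                 (lehmer-isLehmerCode σ) =
  fromLehmer c , π-perm ,
  Equivalence.from (avoids-124-3⇔NoChain (IsPermutation.unique π-perm))
    (subst (NoChain _≤_ _<_) (sym lehmer-π) nc) ,
  Ψπ≡σ
  where
  open ≡-Reasoning
  lehmer-π : lehmer (fromLehmer c) ≡ c
  lehmer-π = lehmer-fromLehmer c c-code
  π-perm : IsPermutation n (fromLehmer c)
  π-perm = IsPermutation-resp-length
    (trans (sym (length-Φ c)) (trans (cong length Φc≡) (trans (length-lehmer σ) (IsPermutation.length≡ q))))
    (fromLehmer-isPermutation c c-code)
  Ψπ≡σ : Ψ (fromLehmer c) ≡ σ
  Ψπ≡σ = begin
    fromLehmer (Φ (lehmer (fromLehmer c))) ≡⟨ cong (fromLehmer ∘ Φ) lehmer-π ⟩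
    fromLehmer (Φ c)                       ≡⟨ cong fromLehmer Φc≡ ⟩
    fromLehmer (lehmer σ)                  ≡⟨ fromLehmer-lehmer q ⟩
    σ                                      ∎

avoiders-≡ : (K : List ℕ → Bool) → (∀ {n π} → IsPermutation n π → K (Ψ π) ≡ K π) → ∀ n →
  count (λ π → avoids p124-3 π ∧ K π) (S n) ≡ count (λ π → avoids p134-2 π ∧ K π) (S n)
avoiders-≡ K K-Ψ n = count-bijection (λ π → avoids p124-3 π ∧ K π) (λ π → avoids p134-2 π ∧ K π) Ψ
  (S-unique n) (S-unique n) maps-to injective surjective
  where
  split : ∀ p {π} → T (avoids p π ∧ K π) → T (avoids p π) × T (K π)
  split p {π} = Equivalence.to (T-∧ {avoids p π} {K π})

  join : ∀ p {π} → T (avoids p π) → T (K π) → T (avoids p π ∧ K π)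
  join p {π} av k = Equivalence.from (T-∧ {avoids p π} {K π}) (av , k)

  maps-to : ∀ {π} → π ∈ S n → T (avoids p124-3 π ∧ K π) → Ψ π ∈ S n × T (avoids p134-2 (Ψ π) ∧ K (Ψ π))
  maps-to {π} π∈ t =
    let p = ∈-S⁻ {n} π∈
        (av , k) = split p124-3 {π} t
    in ∈-S⁺ (Ψ-isPermutation p) , join p134-2 (Ψ-avoids p av) (subst T (sym (K-Ψ p)) k)

  injective : ∀ {π π′} → π ∈ S n → π′ ∈ S n → T (avoids p124-3 π ∧ K π) → T (avoids p124-3 π′ ∧ K π′) →
    Ψ π ≡ Ψ π′ → π ≡ π′
  injective {π} {π′} π∈ π′∈ t t′ =
    Ψ-injective (∈-S⁻ {n} π∈) (∈-S⁻ {n} π′∈) (proj₁ (split p124-3 {π} t)) (proj₁ (split p124-3 {π′} t′))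

  surjective : ∀ {σ} → σ ∈ S n → T (avoids p134-2 σ ∧ K σ) →
    ∃[ π ] (π ∈ S n × T (avoids p124-3 π ∧ K π) × Ψ π ≡ σ)
  surjective {σ} σ∈ t =
    let (av , k) = split p134-2 {σ} t
        (π , p , av′ , Ψπ≡σ) = Ψ-surjective (∈-S⁻ {n} σ∈) av
    in π , ∈-S⁺ p , join p124-3 av′ (subst T (trans (cong K (sym Ψπ≡σ)) (K-Ψ p)) k) , Ψπ≡σ

corollary4p2 : WilfEquivalent p124-3 p134-2
    × (∀ (n a : ℕ) → 1 ≤ n → 1 ≤ a → a ≤ n →
         numAvoidersFirst p124-3 n a ≡ numAvoidersFirst p134-2 n a)
corollary4p2 = wilf , λ n a _ _ _ → avoiders-≡ (firstIs a) (Ψ-firstIs a) n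
  where
  open ≡-Reasoning
  wilf : WilfEquivalent p124-3 p134-2
  wilf n = begin
    numAvoiders p124-3 n                       ≡⟨ count-cong (λ π → sym (∧-identityʳ (avoids p124-3 π))) (S n) ⟩
    count (λ π → avoids p124-3 π ∧ true) (S n) ≡⟨ avoiders-≡ (λ _ → true) (λ _ → refl) n ⟩
    count (λ π → avoids p134-2 π ∧ true) (S n) ≡⟨ count-cong (λ π → ∧-identityʳ (avoids p134-2 π)) (S n) ⟩
    numAvoiders p134-2 n                       ∎
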